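{- Let $\mathbb{F}$ be a field of characteristic $0$, let $n\in\mathbb{N}$, $\varkappa=(\varkappa_1,\ldots,\varkappa_n)\in\mathbb{N}^n$ (all $\varkappa_j\ge 1$), and $m\in\mathbb{N}_0$. Then the following identity holds in the field of rational functions $\mathbb{F}(y_1,\ldots,y_n)$: \[ \operatorname{h}_m(y^{[\varkappa]})=\sum_{s=1}^{n}\sum_{r=1}^{\varkappa_s} A_{y,\varkappa,s,r}\binom{m+r-1}{r-1}\,y_s^m . \] As a consequence, the same identity holds when $y_1,\ldots,y_n$ are pairwise different elements of $\mathbb{F}$.
   Context: For variables $x_1,\ldots,x_N$ and $m\in\mathbb{N}_0$, the complete homogeneous polynomial is $\operatorname{h}_m(x_1,\ldots,x_N)=\sum_{k\in\mathbb{N}_0^N,\ k_1+\cdots+k_N=m} x_1^{k_1}\cdots x_N^{k_N}$ (so $\operatorname{h}_0=1$). For $\varkappa\in\mathbb{N}_0^n$, $y^{[\varkappa]}$ denotes the list of length $|\varkappa|=\varkappa_1+\cdots+\varkappa_n$ consisting of $y_1$ repeated $\varkappa_1$ times, then $y_2$ repeated $\varkappa_2$ times, ..., then $y_n$ repeated $\varkappa_n$ times. For $s\in\{1,\ldots,n\}$ and $r\in\{1,\ldots,\varkappa_s\}$, define \[ A_{y,\varkappa,s,r}=\frac{(-y_s)^{|\varkappa|-\varkappa_s}}{\prod_{d\in\{1,\ldots,n\}\setminus\{s\}}(y_d-y_s)^{\varkappa_d}}\;\operatorname{h}_{\varkappa_s-r}(w), \] where $w$ is the list of length $|\varkappa|-\varkappa_s$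 obtained by listing, for $d=1,\ldots,n$ with $d\ne s$ in increasing order, the element $y_d/(y_d-y_s)$ repeated $\varkappa_d$ times. -}

module Defs where

open import Level using (Level; _⊔_) renaming (suc to lsuc)
open import Data.Nat using (ℕ; zero; suc; _∸_) renaming (_+_ to _+ℕ_)
open import Data.Fin using (Fin; _≟_)
open import Data.List using (List; []; _∷_; map; concat; concatMap; replicate; allFin; upTo; foldr; filter; length; zipWith)
open import Data.Product using (_,_)
open import Relation.Nullary using (¬_; yes; no)
open import Relation.Nullary.Decidable using (¬?)
open import Algebra.Bundles using (CommutativeRing)

-- The inverse is a total operation whose
-- value at 0 is unconstrained (only ever used on nonzero elements).
record Field (c ℓ : Level) : Set (lsuc (c ⊔ ℓ)) where
  field
    commutativeRing : CommutativeRing c ℓ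
  open CommutativeRing commutativeRing public
  field
    _⁻¹        : Carrier → Carrier
    ⁻¹-inverse : ∀ x → ¬ (x ≈ 0#) → x * (x ⁻¹) ≈ 1#
    0≉1        : ¬ (0# ≈ 1#)

∣_∣ₖ : {n : ℕ} → (Fin n → ℕ) → ℕ
∣_∣ₖ {n} κ = foldr _+ℕ_ 0 (map κ (allFin n))

compositions : ℕ → ℕ → List (List ℕ)
compositions zero    zero    = [] ∷ []
compositions zero    (suc m) = []
compositions (suc N) m       =
  concatMap (λ k → map (k ∷_) (compositions N (m ∸ k))) (upTo (suc m))

module FieldOps {c ℓ : Level} (F : Field c ℓ) where
  open Field F

  sumF : List Carrier → Carrier
  sumF = foldr _+_ 0#

  prodF : List Carrier → Carrier
  prodF = foldr _*_ 1#

  infixr 8 _^ₙ_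
  _^ₙ_ : Carrier → ℕ → Carrier
  x ^ₙ zero  = 1#
  x ^ₙ suc k = x * (x ^ₙ k)

  fromℕ : ℕ → Carrier
  fromℕ zero    = 0#
  fromℕ (suc k) = 1# + fromℕ k

  CharZero : Set ℓ
  CharZero = ∀ k → ¬ (fromℕ (suc k) ≈ 0#)

  _/_ : Carrier → Carrier → Carrier
  x / y = x * (y ⁻¹)

  h : ℕ → List Carrier → Carrier
  h m xs = sumF (map (λ k → prodF (zipWith _^ₙ_ xs k)) (compositions (length xs) m))

  repList : {n : ℕ} → (Fin n → Carrier) → (Fin n → ℕ) → List Carrier
  repList {n} y κ = concatMap (λ d → replicate (κ d) (y d)) (allFin n)

  others : {n : ℕ} → Fin n → List (Fin n)
  others {n} s = filter (λ d → ¬? (d ≟ s)) (allFin n)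

  wList : {n : ℕ} → (Fin n → Carrier) → (Fin n → ℕ) → Fin n → List Carrier
  wList y κ s = concatMap (λ d → replicate (κ d) (y d / (y d - y s))) (others s)

  A : {n : ℕ} → (Fin n → Carrier) → (Fin n → ℕ) → Fin n → ℕ → Carrier
  A y κ s r =
    (((- (y s)) ^ₙ (∣ κ ∣ₖ ∸ κ s))
      / prodF (map (λ d → (y d - y s) ^ₙ κ d) (others s)))
    * h (κ s ∸ r) (wList y κ s)

module Submission where

-- Both sides, as functions of the multiplicities κ and of m, satisfy
--   (y_a − y_b) · X(κ, m) = X(κ − e_b, m + 1) − X(κ − e_a, m + 1)      (a ≠ b, κ_a, κ_b ≥ 1).
-- On the left this holds because m ↦ h_m(y^[κ]) is the coefficient sequence of
-- ∏_d (1 − y_d t)^(−κ_d).  On the right, the s-th summand is, up to its prefactor, the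
-- coefficient of t^(κ_s) in t · h(w)(t) / (1 − t)^(m+1) with h(w)(t) = ∏_{d≠s} (1 − w_d t)^(−κ_d).
-- Lowering κ_b for b ≠ s multiplies this series by 1 − w_b t and the prefactor by
-- (y_s − y_b)/y_s, so each of the cases s = a, s = b, s ∉ {a, b} reduces to an identity
-- between linear polynomials in t.  Induction on |κ|, over all κ with nonempty support
-- (lowering entries creates zeros), ends at κ supported on a single index a, where both
-- sides equal C(m + k, k) y_a^m for κ_a = k + 1.

open import Defs
open import Level using (Level)
open import Algebra.Bundles using (CommutativeRing; Monoid; CommutativeMonoid)
open import Algebra.Solver.Ring.AlmostCommutativeRing
  using (fromCommutativeRing; _-Raw-AlmostCommutative⟶_)
import Algebra.Solver.Ring
open import Data.Fin using (Fin; zero; suc; _≟_)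
open import Data.Fin.Properties using (any?; suc-injective)
open import Data.Integer as ℤ using (ℤ; +_; -[1+_]; _⊖_; _◃_)
import Data.Integer.Properties as ℤ
open import Data.List using (List; []; _∷_; _++_; map; foldr; filter; replicate; allFin; upTo; concatMap; zipWith; length)
import Data.List.Properties as List
open import Data.Maybe using (Maybe; just; nothing)
open import Data.Nat as ℕ using (ℕ; zero; suc; _∸_; _≤_; _≤?_) renaming (_+_ to _+ℕ_)
import Data.Nat.Properties as ℕ
open import Data.Nat.Combinatorics using (_C_; nCn≡1; nCk+nC[k+1]≡[n+1]C[k+1])
open import Data.Product using (_,_)
import Data.Sign as Sign
open import Data.Vec.Functional using (updateAt)
open import Data.Vec.Functional.Properties using (updateAt-updates; updateAt-minimal)
open import Function using (_∘_; const)
open import Relation.Binary.PropositionalEquality as ≡ using (_≡_; _≢_)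
open import Relation.Nullary using (¬_; yes; no; contradiction)
open import Relation.Nullary.Decidable using (¬?; _×-dec_)

-- Normal forms are compared by `refl`, so the coefficients must come from a
-- ring with decidable equality; ℤ is mapped into any commutative ring.
module IntegerRingSolver {c ℓ : Level} (R : CommutativeRing c ℓ) where
  open CommutativeRing R
  open import Algebra.Properties.Semiring.Mult semiring using (_×_; ×-homo-+; ×1-homo-*)
  open import Algebra.Properties.Ring ring using (-‿distribˡ-*; -‿distribʳ-*)
  open import Algebra.Properties.AbelianGroup +-abelianGroup using (ε⁻¹≈ε; ⁻¹-involutive; ⁻¹-∙-comm)
  open import Relation.Binary.Reasoning.Setoid setoid

  fromℤ : ℤ → Carrier
  fromℤ (+ n)      = n × 1#
  fromℤ (-[1+ n ]) = - (suc n × 1#)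

  fromℤ-⊖ : ∀ m n → fromℤ (m ⊖ n) ≈ m × 1# - n × 1#
  fromℤ-⊖ m       zero    = trans (sym (+-identityʳ _)) (+-congˡ (sym ε⁻¹≈ε))
  fromℤ-⊖ zero    (suc n) = sym (+-identityˡ _)
  fromℤ-⊖ (suc m) (suc n) = begin
    fromℤ (suc m ⊖ suc n)    ≡⟨ ≡.cong fromℤ (ℤ.[1+m]⊖[1+n]≡m⊖n m n) ⟩
    fromℤ (m ⊖ n)            ≈⟨ fromℤ-⊖ m n ⟩
    M - N                    ≈⟨ +-congʳ (sym (+-identityˡ M)) ⟩
    (0# + M) - N             ≈⟨ +-congʳ (+-congʳ (sym (-‿inverseʳ 1#))) ⟩
    ((1# - 1#) + M) - N      ≈⟨ +-congʳ (+-assoc _ _ _) ⟩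
    (1# + (- 1# + M)) - N    ≈⟨ +-congʳ (+-congˡ (+-comm _ _)) ⟩
    (1# + (M - 1#)) - N      ≈⟨ +-congʳ (sym (+-assoc _ _ _)) ⟩
    ((1# + M) - 1#) - N      ≈⟨ +-assoc _ _ _ ⟩
    (1# + M) + (- 1# - N)    ≈⟨ +-congˡ (⁻¹-∙-comm _ _) ⟩
    (1# + M) - (1# + N)      ∎
    where M = m × 1#; N = n × 1#

  fromℤ-◃⁺ : ∀ n → fromℤ (Sign.+ ◃ n) ≈ n × 1#
  fromℤ-◃⁺ zero    = refl
  fromℤ-◃⁺ (suc n) = refl

  fromℤ-◃⁻ : ∀ n → fromℤ (Sign.- ◃ n) ≈ - (n × 1#)
  fromℤ-◃⁻ zero    = sym ε⁻¹≈ε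
  fromℤ-◃⁻ (suc n) = refl

  fromℤ-+ : ∀ i j → fromℤ (i ℤ.+ j) ≈ fromℤ i + fromℤ j
  fromℤ-+ (+ m)    (+ n)    = ×-homo-+ 1# m n
  fromℤ-+ (+ m)    -[1+ n ] = fromℤ-⊖ m (suc n)
  fromℤ-+ -[1+ m ] (+ n)    = trans (fromℤ-⊖ n (suc m)) (+-comm _ _)
  fromℤ-+ -[1+ m ] -[1+ n ] = begin
    - (1# + (suc m ℕ.+ n) × 1#)          ≈⟨ -‿cong (+-congˡ (×-homo-+ 1# (suc m) n)) ⟩
    - (1# + (suc m × 1# + n × 1#))       ≈⟨ -‿cong (+-congˡ (+-comm _ _)) ⟩
    - (1# + (n × 1# + suc m × 1#))       ≈⟨ -‿cong (sym (+-assoc _ _ _)) ⟩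
    - (suc n × 1# + suc m × 1#)          ≈⟨ -‿cong (+-comm _ _) ⟩
    - (suc m × 1# + suc n × 1#)          ≈⟨ ⁻¹-∙-comm _ _ ⟨
    - (suc m × 1#) + - (suc n × 1#)      ∎

  fromℤ-* : ∀ i j → fromℤ (i ℤ.* j) ≈ fromℤ i * fromℤ j
  fromℤ-* (+ m)    (+ n)    = trans (fromℤ-◃⁺ (m ℕ.* n)) (×1-homo-* m n)
  fromℤ-* (+ m)    -[1+ n ] = trans (fromℤ-◃⁻ (m ℕ.* suc n)) (trans (-‿cong (×1-homo-* m (suc n))) (-‿distribʳ-* _ _))
  fromℤ-* -[1+ m ] (+ n)    = trans (fromℤ-◃⁻ (suc m ℕ.* n)) (trans (-‿cong (×1-homo-* (suc m) n)) (-‿distribˡ-* _ _))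
  fromℤ-* -[1+ m ] -[1+ n ] = begin
    fromℤ (Sign.+ ◃ (suc m ℕ.* suc n))  ≈⟨ fromℤ-◃⁺ (suc m ℕ.* suc n) ⟩
    (suc m ℕ.* suc n) × 1#              ≈⟨ ×1-homo-* (suc m) (suc n) ⟩
    M * N                               ≈⟨ ⁻¹-involutive _ ⟨
    - - (M * N)                         ≈⟨ -‿cong (-‿distribˡ-* M N) ⟩
    - (- M * N)                         ≈⟨ -‿distribʳ-* (- M) N ⟩
    - M * - N                           ∎
    where M = suc m × 1#; N = suc n × 1#

  fromℤ-neg : ∀ i → fromℤ (ℤ.- i) ≈ - fromℤ i
  fromℤ-neg (+ zero)  = sym ε⁻¹≈ε
  fromℤ-neg (+ suc n) = refl
  fromℤ-neg -[1+ n ]  = sym (⁻¹-involutive _)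

  fromℤ-homomorphism :
    CommutativeRing.rawRing ℤ.+-*-commutativeRing -Raw-AlmostCommutative⟶ fromCommutativeRing R
  fromℤ-homomorphism = record
    { ⟦_⟧ = fromℤ ; +-homo = fromℤ-+ ; *-homo = fromℤ-* ; -‿homo = fromℤ-neg
    ; 0-homo = refl ; 1-homo = +-identityʳ 1# }

  fromℤ-equal? : ∀ i j → Maybe (fromℤ i ≈ fromℤ j)
  fromℤ-equal? i j with i ℤ.≟ j
  ... | yes ≡.refl = just refl
  ... | no _       = nothing

  open Algebra.Solver.Ring (CommutativeRing.rawRing ℤ.+-*-commutativeRing) (fromCommutativeRing R)
    fromℤ-homomorphism fromℤ-equal? public using (solve; _:+_; _:*_; _:-_; :-_; _:=_; con)

map-upTo-suc : ∀ {a} {A : Set a} (f : ℕ → A) n → map f (upTo (suc n)) ≡ f 0 ∷ map (f ∘ suc) (upTo n)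
map-upTo-suc f n = ≡.trans (List.map-upTo f (suc n)) (≡.cong (f 0 ∷_) (≡.sym (List.map-upTo (f ∘ suc) n)))

map-allFin-suc : ∀ {a} {A : Set a} {n} (f : Fin (suc n) → A) → map f (allFin (suc n)) ≡ f zero ∷ map (f ∘ suc) (allFin n)
map-allFin-suc f =
  ≡.trans (List.map-tabulate (λ d → d) f) (≡.cong (f zero ∷_) (≡.sym (List.map-tabulate (λ d → d) (f ∘ suc))))

module _ {a ℓ : Level} (M : Monoid a ℓ) where
  open Monoid M
  open import Relation.Binary.Reasoning.Setoid setoid

  -- For (ℕ, +), (R, *), (R, +) and (List, ++) this unfolds to ∣_∣ₖ, prodF, sumF and repList.
  ⨁ : ∀ {n} → (Fin n → Carrier) → Carrier
  ⨁ {n} f = foldr _∙_ ε (map f (allFin n))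

  ⨁-suc : ∀ {n} (f : Fin (suc n) → Carrier) → ⨁ f ≡ f zero ∙ ⨁ (f ∘ suc)
  ⨁-suc f = ≡.cong (foldr _∙_ ε) (map-allFin-suc f)

  ⨁-cong : ∀ {n} (f g : Fin n → Carrier) → (∀ d → f d ≈ g d) → ⨁ f ≈ ⨁ g
  ⨁-cong {zero}  f g f≈g = refl
  ⨁-cong {suc n} f g f≈g = begin
    ⨁ f                   ≡⟨ ⨁-suc f ⟩
    f zero ∙ ⨁ (f ∘ suc)  ≈⟨ ∙-cong (f≈g zero) (⨁-cong (f ∘ suc) (g ∘ suc) (f≈g ∘ suc)) ⟩
    g zero ∙ ⨁ (g ∘ suc)  ≡⟨ ⨁-suc g ⟨
    ⨁ g                   ∎

  ⨁-ε : ∀ {n} (f : Fin n → Carrier) → (∀ d → f d ≈ ε) → ⨁ f ≈ ε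
  ⨁-ε {zero}  f f≈ε = refl
  ⨁-ε {suc n} f f≈ε = begin
    ⨁ f                   ≡⟨ ⨁-suc f ⟩
    f zero ∙ ⨁ (f ∘ suc)  ≈⟨ ∙-cong (f≈ε zero) (⨁-ε (f ∘ suc) (f≈ε ∘ suc)) ⟩
    ε ∙ ε                 ≈⟨ identityˡ ε ⟩
    ε                     ∎

  ⨁-single : ∀ {n} (f : Fin n → Carrier) a → (∀ d → d ≢ a → f d ≈ ε) → ⨁ f ≈ f a
  ⨁-single {suc n} f zero    f≈ε = begin
    ⨁ f                   ≡⟨ ⨁-suc f ⟩
    f zero ∙ ⨁ (f ∘ suc)  ≈⟨ ∙-congˡ (⨁-ε (f ∘ suc) (λ d → f≈ε (suc d) λ ())) ⟩
    f zero ∙ ε            ≈⟨ identityʳ _ ⟩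
    f zero                ∎
  ⨁-single {suc n} f (suc a) f≈ε = begin
    ⨁ f                   ≡⟨ ⨁-suc f ⟩
    f zero ∙ ⨁ (f ∘ suc)  ≈⟨ ∙-congʳ (f≈ε zero λ ()) ⟩
    ε ∙ ⨁ (f ∘ suc)       ≈⟨ identityˡ _ ⟩
    ⨁ (f ∘ suc)           ≈⟨ ⨁-single (f ∘ suc) a (λ d d≢a → f≈ε (suc d) (d≢a ∘ suc-injective)) ⟩
    f (suc a)             ∎

  foldr-filter-≢ : ∀ {n} (s : Fin n) (f g : Fin n → Carrier) xs → (∀ d → d ≢ s → f d ≈ g d) → g s ≈ ε →
    foldr _∙_ ε (map f (filter (λ d → ¬? (d ≟ s)) xs)) ≈ foldr _∙_ ε (map g xs)
  foldr-filter-≢ s f g []       f≈g gs≈ε = refl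
  foldr-filter-≢ s f g (d ∷ xs) f≈g gs≈ε with d ≟ s
  ... | yes ≡.refl = trans (foldr-filter-≢ s f g xs f≈g gs≈ε) (sym (trans (∙-congʳ gs≈ε) (identityˡ _)))
  ... | no d≢s     = ∙-cong (f≈g d d≢s) (foldr-filter-≢ s f g xs f≈g gs≈ε)

module _ {a ℓ : Level} (M : CommutativeMonoid a ℓ) where
  open CommutativeMonoid M
  open import Algebra.Properties.CommutativeSemigroup commutativeSemigroup using (x∙yz≈y∙xz)
  open import Relation.Binary.Reasoning.Setoid setoid

  ⨁-step : ∀ {n} (f g : Fin n → Carrier) x b → f b ≈ x ∙ g b → (∀ d → d ≢ b → f d ≈ g d) →
    ⨁ monoid f ≈ x ∙ ⨁ monoid g
  ⨁-step {suc n} f g x zero    fb f≈g = begin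
    ⨁ monoid f                          ≡⟨ ⨁-suc monoid f ⟩
    f zero ∙ ⨁ monoid (f ∘ suc)         ≈⟨ ∙-cong fb (⨁-cong monoid (f ∘ suc) (g ∘ suc) (λ d → f≈g (suc d) λ ())) ⟩
    (x ∙ g zero) ∙ ⨁ monoid (g ∘ suc)   ≈⟨ assoc _ _ _ ⟩
    x ∙ (g zero ∙ ⨁ monoid (g ∘ suc))   ≡⟨ ≡.cong (x ∙_) (⨁-suc monoid g) ⟨
    x ∙ ⨁ monoid g                      ∎
  ⨁-step {suc n} f g x (suc b) fb f≈g = begin
    ⨁ monoid f                          ≡⟨ ⨁-suc monoid f ⟩
    f zero ∙ ⨁ monoid (f ∘ suc)         ≈⟨ ∙-cong (f≈g zero λ ()) (⨁-step (f ∘ suc) (g ∘ suc) x b fb f≈g-tail) ⟩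
    g zero ∙ (x ∙ ⨁ monoid (g ∘ suc))   ≈⟨ x∙yz≈y∙xz _ _ _ ⟩
    x ∙ (g zero ∙ ⨁ monoid (g ∘ suc))   ≡⟨ ≡.cong (x ∙_) (⨁-suc monoid g) ⟨
    x ∙ ⨁ monoid g                      ∎
    where
    f≈g-tail : ∀ d → d ≢ b → f (suc d) ≈ g (suc d)
    f≈g-tail d d≢b = f≈g (suc d) (d≢b ∘ suc-injective)

infix  4 _≗_+𝐞_
infixl 6 _-𝐞_

record _≗_+𝐞_ {n} (κ κ′ : Fin n → ℕ) (b : Fin n) : Set where
  field
    at        : κ b ≡ suc (κ′ b)
    elsewhere : ∀ d → d ≢ b → κ d ≡ κ′ d

open _≗_+𝐞_

_-𝐞_ : ∀ {n} → (Fin n → ℕ) → Fin n → Fin n → ℕ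
κ -𝐞 a = updateAt κ a ℕ.pred

-𝐞-+𝐞 : ∀ {n} {κ : Fin n → ℕ} {a} → 1 ≤ κ a → κ ≗ κ -𝐞 a +𝐞 a
-𝐞-+𝐞 {κ = κ} {a} 1≤κa = record
  { at        = ≡.trans (≡.sym (ℕ.suc-pred (κ a) ⦃ ℕ.>-nonZero 1≤κa ⦄)) (≡.cong suc (≡.sym (updateAt-updates a κ)))
  ; elsewhere = λ d d≢a → ≡.sym (updateAt-minimal d a κ d≢a)
  }

zeroAt : ∀ {n} → Fin n → (Fin n → ℕ) → Fin n → ℕ
zeroAt s κ = updateAt κ s (const 0)

zeroAt-agree : ∀ {n} {κ κ′ : Fin n → ℕ} s d → (d ≢ s → κ d ≡ κ′ d) → zeroAt s κ d ≡ zeroAt s κ′ d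
zeroAt-agree {κ = κ} {κ′} s d κd≡κ′d with d ≟ s
... | yes ≡.refl = ≡.trans (updateAt-updates s κ) (≡.sym (updateAt-updates s κ′))
... | no d≢s     = ≡.trans (updateAt-minimal d s κ d≢s) (≡.trans (κd≡κ′d d≢s) (≡.sym (updateAt-minimal d s κ′ d≢s)))

zeroAt-+𝐞 : ∀ {n} {κ κ′ : Fin n → ℕ} {b s} → s ≢ b → κ ≗ κ′ +𝐞 b → zeroAt s κ ≗ zeroAt s κ′ +𝐞 b
zeroAt-+𝐞 {κ = κ} {κ′} {b} {s} s≢b κ=κ′+b = record
  { at        = ≡.trans (updateAt-minimal b s κ b≢s)
                  (≡.trans (at κ=κ′+b) (≡.cong suc (≡.sym (updateAt-minimal b s κ′ b≢s))))
  ; elsewhere = λ d d≢b → zeroAt-agree s d (λ _ → elsewhere κ=κ′+b d d≢b)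
  }
  where
  b≢s : b ≢ s
  b≢s = s≢b ∘ ≡.sym

+𝐞-tail : ∀ {n} {κ κ′ : Fin (suc n) → ℕ} {b} → κ ≗ κ′ +𝐞 suc b → κ ∘ suc ≗ κ′ ∘ suc +𝐞 b
+𝐞-tail κ=κ′+b = record
  { at        = at κ=κ′+b
  ; elsewhere = λ d d≢b → elsewhere κ=κ′+b (suc d) (d≢b ∘ suc-injective)
  }

∣∣ₖ-+𝐞 : ∀ {n} {κ κ′ : Fin n → ℕ} {b} → κ ≗ κ′ +𝐞 b → ∣ κ ∣ₖ ≡ suc ∣ κ′ ∣ₖ
∣∣ₖ-+𝐞 {κ = κ} {κ′} {b} κ=κ′+b = ⨁-step ℕ.+-0-commutativeMonoid κ κ′ 1 b (at κ=κ′+b) (elsewhere κ=κ′+b)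

∣∣ₖ-single : ∀ {n} (κ : Fin n → ℕ) a → (∀ d → d ≢ a → κ d ≡ 0) → ∣ κ ∣ₖ ≡ κ a
∣∣ₖ-single κ a = ⨁-single ℕ.+-0-monoid κ a

≤∣∣ₖ : ∀ {n} (κ : Fin n → ℕ) d → κ d ≤ ∣ κ ∣ₖ
≤∣∣ₖ {suc n} κ d = ≡.subst (κ d ≤_) (≡.sym (⨁-suc ℕ.+-0-monoid κ)) (≤head+tail d)
  where
  ≤head+tail : ∀ d → κ d ≤ κ zero +ℕ ∣ κ ∘ suc ∣ₖ
  ≤head+tail zero    = ℕ.m≤m+n (κ zero) _
  ≤head+tail (suc d) = ℕ.≤-trans (≤∣∣ₖ (κ ∘ suc) d) (ℕ.m≤n+m _ (κ zero))

module _ {c ℓ : Level} (F : Field c ℓ) where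
  open Field F hiding (zero)
  open FieldOps F
  open IntegerRingSolver commutativeRing
  open import Relation.Binary.Reasoning.Setoid setoid

  ⁻¹-inverseˡ : ∀ x → x ≉ 0# → x ⁻¹ * x ≈ 1#
  ⁻¹-inverseˡ x x≉0 = trans (*-comm _ _) (⁻¹-inverse x x≉0)

  *-cancelˡ : ∀ {x y z} → x ≉ 0# → x * y ≈ x * z → y ≈ z
  *-cancelˡ {x} {y} {z} x≉0 xy≈xz = begin
    y                ≈⟨ *-identityˡ y ⟨
    1# * y           ≈⟨ *-congʳ (⁻¹-inverseˡ x x≉0) ⟨
    (x ⁻¹ * x) * y   ≈⟨ *-assoc _ _ _ ⟩
    x ⁻¹ * (x * y)   ≈⟨ *-congˡ xy≈xz ⟩
    x ⁻¹ * (x * z)   ≈⟨ *-assoc _ _ _ ⟨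
    (x ⁻¹ * x) * z   ≈⟨ *-congʳ (⁻¹-inverseˡ x x≉0) ⟩
    1# * z           ≈⟨ *-identityˡ z ⟩
    z                ∎

  *-≉0 : ∀ {x y} → x ≉ 0# → y ≉ 0# → x * y ≉ 0#
  *-≉0 {x} x≉0 y≉0 xy≈0 = y≉0 (*-cancelˡ x≉0 (trans xy≈0 (sym (zeroʳ x))))

  ^ₙ-≉0 : ∀ {x} k → x ≉ 0# → x ^ₙ k ≉ 0#
  ^ₙ-≉0 zero    x≉0 = 0≉1 ∘ sym
  ^ₙ-≉0 (suc k) x≉0 = *-≉0 x≉0 (^ₙ-≉0 k x≉0)

  prodF-≉0 : ∀ {A : Set} (f : A → Carrier) xs → (∀ a → f a ≉ 0#) → prodF (map f xs) ≉ 0#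
  prodF-≉0 f []       f≉0 = 0≉1 ∘ sym
  prodF-≉0 f (x ∷ xs) f≉0 = *-≉0 (f≉0 x) (prodF-≉0 f xs f≉0)

  -≉0 : ∀ {x y} → x ≉ y → x - y ≉ 0#
  -≉0 {x} {y} x≉y x-y≈0 = x≉y (begin
    x              ≈⟨ solve 2 (λ x y → x := (x :- y) :+ y) refl x y ⟩
    (x - y) + y    ≈⟨ +-congʳ x-y≈0 ⟩
    0# + y         ≈⟨ +-identityˡ y ⟩
    y              ∎)

  ⁻¹-unique : ∀ {x y} → x ≉ 0# → x * y ≈ 1# → y ≈ x ⁻¹
  ⁻¹-unique {x} x≉0 xy≈1 = *-cancelˡ x≉0 (trans xy≈1 (sym (⁻¹-inverse x x≉0)))

  ⁻¹-cong : ∀ {x y} → x ≉ 0# → x ≈ y → x ⁻¹ ≈ y ⁻¹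
  ⁻¹-cong {x} x≉0 x≈y = ⁻¹-unique (x≉0 ∘ trans x≈y) (trans (*-congʳ (sym x≈y)) (⁻¹-inverse x x≉0))

  ⁻¹-distrib-* : ∀ {x y} → x ≉ 0# → y ≉ 0# → (x * y) ⁻¹ ≈ x ⁻¹ * y ⁻¹
  ⁻¹-distrib-* {x} {y} x≉0 y≉0 = sym (⁻¹-unique (*-≉0 x≉0 y≉0) (begin
    (x * y) * (x ⁻¹ * y ⁻¹)
      ≈⟨ solve 4 (λ x y x′ y′ → (x :* y) :* (x′ :* y′) := (x :* x′) :* (y :* y′)) refl x y (x ⁻¹) (y ⁻¹) ⟩
    (x * x ⁻¹) * (y * y ⁻¹)     ≈⟨ *-cong (⁻¹-inverse x x≉0) (⁻¹-inverse y y≉0) ⟩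
    1# * 1#                     ≈⟨ *-identityˡ 1# ⟩
    1#                          ∎))

  1⁻¹≈1 : 1# ⁻¹ ≈ 1#
  1⁻¹≈1 = sym (⁻¹-unique (0≉1 ∘ sym) (*-identityˡ 1#))

  sumF-cong : ∀ {A : Set} {f g : A → Carrier} xs → (∀ a → f a ≈ g a) → sumF (map f xs) ≈ sumF (map g xs)
  sumF-cong []       f≈g = refl
  sumF-cong (x ∷ xs) f≈g = +-cong (f≈g x) (sumF-cong xs f≈g)

  sumF-*ˡ : ∀ {A : Set} x (f : A → Carrier) xs → sumF (map (λ a → x * f a) xs) ≈ x * sumF (map f xs)
  sumF-*ˡ x f []       = sym (zeroʳ x)
  sumF-*ˡ x f (y ∷ ys) = trans (+-congˡ (sumF-*ˡ x f ys)) (sym (distribˡ _ _ _))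

  sumF-- : ∀ {A : Set} (f g : A → Carrier) xs → sumF (map (λ a → f a - g a) xs) ≈ sumF (map f xs) - sumF (map g xs)
  sumF-- f g []       = solve 0 (con (+ 0) := con (+ 0) :- con (+ 0)) refl
  sumF-- f g (x ∷ xs) = trans (+-congˡ (sumF-- f g xs))
    (solve 4 (λ a b c d → (a :- b) :+ (c :- d) := (a :+ c) :- (b :+ d)) refl (f x) (g x) _ _)

  sumF-++ : ∀ xs ys → sumF (xs ++ ys) ≈ sumF xs + sumF ys
  sumF-++ []       ys = sym (+-identityˡ _)
  sumF-++ (x ∷ xs) ys = trans (+-congˡ (sumF-++ xs ys)) (sym (+-assoc _ _ _))

  sumF-concatMap : ∀ {A B : Set} (f : B → Carrier) (g : A → List B) xs →
    sumF (map f (concatMap g xs)) ≈ sumF (map (λ a → sumF (map f (g a))) xs)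
  sumF-concatMap f g []       = refl
  sumF-concatMap f g (x ∷ xs) = begin
    sumF (map f (g x ++ concatMap g xs))              ≡⟨ ≡.cong sumF (List.map-++ f (g x) (concatMap g xs)) ⟩
    sumF (map f (g x) ++ map f (concatMap g xs))      ≈⟨ sumF-++ (map f (g x)) _ ⟩
    sumF (map f (g x)) + sumF (map f (concatMap g xs)) ≈⟨ +-congˡ (sumF-concatMap f g xs) ⟩
    sumF (map (λ a → sumF (map f (g a))) (x ∷ xs))   ∎

  prodF-^ₙ-+𝐞 : ∀ {n} (g : Fin n → Carrier) {κ κ′ b} → κ ≗ κ′ +𝐞 b →
    prodF (map (λ d → g d ^ₙ κ d) (allFin n)) ≈ g b * prodF (map (λ d → g d ^ₙ κ′ d) (allFin n))
  prodF-^ₙ-+𝐞 g κ=κ′+b = ⨁-step *-commutativeMonoid _ _ _ _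
    (reflexive (≡.cong (g _ ^ₙ_) (at κ=κ′+b))) (λ d d≢b → reflexive (≡.cong (g d ^ₙ_) (elsewhere κ=κ′+b d d≢b)))

  rescale : ∀ {z p p′ β} x c → z * p′ ≈ β * p → p′ * (z * x) * c ≈ p * x * (β * c)
  rescale {z} {p} {p′} {β} x c zp′≈βp = begin
    p′ * (z * x) * c       ≈⟨ solve 4 (λ z p′ x c → p′ :* (z :* x) :* c := (z :* p′) :* x :* c) refl z p′ x c ⟩
    (z * p′) * x * c       ≈⟨ *-congʳ (*-congʳ zp′≈βp) ⟩
    (β * p) * x * c        ≈⟨ solve 4 (λ β p x c → (β :* p) :* x :* c := p :* x :* (β :* c)) refl β p x c ⟩
    p * x * (β * c)        ∎

  -- Formal power series

  Series : Set c
  Series = ℕ → Carrier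

  infix 4 _≋_
  _≋_ : Series → Series → Set ℓ
  f ≋ g = ∀ k → f k ≈ g k

  ≋-sym : ∀ {f g} → f ≋ g → g ≋ f
  ≋-sym f≋g k = sym (f≋g k)

  ≋-trans : ∀ {f g h} → f ≋ g → g ≋ h → f ≋ h
  ≋-trans f≋g g≋h k = trans (f≋g k) (g≋h k)

  ≡⇒≋ : ∀ {f g} → f ≡ g → f ≋ g
  ≡⇒≋ ≡.refl k = refl

  𝟙 : Series
  𝟙 zero    = 1#
  𝟙 (suc k) = 0#

  infixr 9 [1-_t]·_ [1-_t]⁻¹·_ ∏[1-_t]⁻¹·_ t·_

  [1-_t]·_ : Carrier → Series → Series
  ([1- x t]· f) zero    = f zero
  ([1- x t]· f) (suc k) = f (suc k) - x * f k

  [1-_t]⁻¹·_ : Carrier → Series → Series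
  ([1- x t]⁻¹· f) zero    = f zero
  ([1- x t]⁻¹· f) (suc k) = f (suc k) + x * ([1- x t]⁻¹· f) k

  ∏[1-_t]⁻¹·_ : List Carrier → Series → Series
  ∏[1- xs t]⁻¹· f = foldr [1-_t]⁻¹·_ f xs

  t·_ : Series → Series
  (t· f) zero    = 0#
  (t· f) (suc k) = f k

  [1-t]·-cong : ∀ x {f g} → f ≋ g → [1- x t]· f ≋ [1- x t]· g
  [1-t]·-cong x f≋g zero    = f≋g zero
  [1-t]·-cong x f≋g (suc k) = +-cong (f≋g (suc k)) (-‿cong (*-congˡ (f≋g k)))

  [1-t]⁻¹·-cong : ∀ x {f g} → f ≋ g → [1- x t]⁻¹· f ≋ [1- x t]⁻¹· g
  [1-t]⁻¹·-cong x f≋g zero    = f≋g zero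
  [1-t]⁻¹·-cong x f≋g (suc k) = +-cong (f≋g (suc k)) (*-congˡ ([1-t]⁻¹·-cong x f≋g k))

  ∏[1-t]⁻¹·-cong : ∀ xs {f g} → f ≋ g → ∏[1- xs t]⁻¹· f ≋ ∏[1- xs t]⁻¹· g
  ∏[1-t]⁻¹·-cong []       f≋g = f≋g
  ∏[1-t]⁻¹·-cong (x ∷ xs) f≋g = [1-t]⁻¹·-cong x (∏[1-t]⁻¹·-cong xs f≋g)

  t·-cong : ∀ {f g} → f ≋ g → t· f ≋ t· g
  t·-cong f≋g zero    = refl
  t·-cong f≋g (suc k) = f≋g k

  [1-t]·[1-t]⁻¹· : ∀ x f → [1- x t]· [1- x t]⁻¹· f ≋ f
  [1-t]·[1-t]⁻¹· x f zero    = refl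
  [1-t]·[1-t]⁻¹· x f (suc k) = solve 3 (λ a x b → (a :+ x :* b) :- x :* b := a) refl (f (suc k)) x (([1- x t]⁻¹· f) k)

  [1-t]⁻¹·[1-t]· : ∀ x f → [1- x t]⁻¹· [1- x t]· f ≋ f
  [1-t]⁻¹·[1-t]· x f zero    = refl
  [1-t]⁻¹·[1-t]· x f (suc k) = begin
    ([1- x t]· f) (suc k) + x * ([1- x t]⁻¹· [1- x t]· f) k
      ≈⟨ +-congˡ (*-congˡ ([1-t]⁻¹·[1-t]· x f k)) ⟩
    (f (suc k) - x * f k) + x * f k
      ≈⟨ solve 3 (λ a x b → (a :- x :* b) :+ x :* b := a) refl (f (suc k)) x (f k) ⟩
    f (suc k)
      ∎

  [1-t]·-injective : ∀ x {f g} → [1- x t]· f ≋ [1- x t]· g → f ≋ g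
  [1-t]·-injective x {f} {g} eq =
    ≋-trans (≋-sym ([1-t]⁻¹·[1-t]· x f)) (≋-trans ([1-t]⁻¹·-cong x eq) ([1-t]⁻¹·[1-t]· x g))

  [1-t]·-comm : ∀ x y f → [1- x t]· [1- y t]· f ≋ [1- y t]· [1- x t]· f
  [1-t]·-comm x y f zero          = refl
  [1-t]·-comm x y f (suc zero)    = solve 4 (λ x y a b → (a :- y :* b) :- x :* b := (a :- x :* b) :- y :* b) refl x y (f 1) (f 0)
  [1-t]·-comm x y f (suc (suc k)) =
    solve 5 (λ x y a b c → (a :- y :* b) :- x :* (b :- y :* c) := (a :- x :* b) :- y :* (b :- x :* c))
      refl x y (f (suc (suc k))) (f (suc k)) (f k)

  [1-t]⁻¹·-comm : ∀ x y f → [1- x t]⁻¹· [1- y t]⁻¹· f ≋ [1- y t]⁻¹· [1- x t]⁻¹· f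
  [1-t]⁻¹·-comm x y f = [1-t]·-injective x ([1-t]·-injective y (≋-trans lhs (≋-sym rhs)))
    where
    lhs : [1- y t]· [1- x t]· [1- x t]⁻¹· [1- y t]⁻¹· f ≋ f
    lhs = ≋-trans ([1-t]·-cong y ([1-t]·[1-t]⁻¹· x _)) ([1-t]·[1-t]⁻¹· y f)
    rhs : [1- y t]· [1- x t]· [1- y t]⁻¹· [1- x t]⁻¹· f ≋ f
    rhs = ≋-trans ([1-t]·-comm y x _) (≋-trans ([1-t]·-cong x ([1-t]·[1-t]⁻¹· y _)) ([1-t]·[1-t]⁻¹· x f))

  ∏[1-t]⁻¹·-comm : ∀ xs x f → ∏[1- xs t]⁻¹· [1- x t]⁻¹· f ≋ [1- x t]⁻¹· ∏[1- xs t]⁻¹· f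
  ∏[1-t]⁻¹·-comm []       x f = λ k → refl
  ∏[1-t]⁻¹·-comm (y ∷ ys) x f = ≋-trans ([1-t]⁻¹·-cong y (∏[1-t]⁻¹·-comm ys x f)) ([1-t]⁻¹·-comm y x _)

  ∏[1-t]⁻¹·-++ : ∀ xs ys f → ∏[1- xs ++ ys t]⁻¹· f ≡ ∏[1- xs t]⁻¹· ∏[1- ys t]⁻¹· f
  ∏[1-t]⁻¹·-++ xs ys f = List.foldr-++ [1-_t]⁻¹·_ f xs ys

  ∏[1-t]⁻¹·-head : ∀ xs f → (∏[1- xs t]⁻¹· f) zero ≡ f zero
  ∏[1-t]⁻¹·-head []       f = ≡.refl
  ∏[1-t]⁻¹·-head (x ∷ xs) f = ∏[1-t]⁻¹·-head xs f

  [1-t]⁻¹·𝟙 : ∀ x k → ([1- x t]⁻¹· 𝟙) k ≈ x ^ₙ k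
  [1-t]⁻¹·𝟙 x zero    = refl
  [1-t]⁻¹·𝟙 x (suc k) = trans (+-identityˡ _) (*-congˡ ([1-t]⁻¹·𝟙 x k))

  infixl 7 _⋆_
  _⋆_ : Series → Series → Series
  (f ⋆ g) zero    = f zero * g zero
  (f ⋆ g) (suc k) = f zero * g (suc k) + ((f ∘ suc) ⋆ g) k

  ⋆-congˡ : ∀ {f f′} g → f ≋ f′ → f ⋆ g ≋ f′ ⋆ g
  ⋆-congˡ g f≋f′ zero    = *-congʳ (f≋f′ zero)
  ⋆-congˡ g f≋f′ (suc k) = +-cong (*-congʳ (f≋f′ zero)) (⋆-congˡ g (f≋f′ ∘ suc) k)

  ⋆-coeff : ∀ f g k → (f ⋆ g) k ≈ sumF (map (λ i → f i * g (k ∸ i)) (upTo (suc k)))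
  ⋆-coeff f g zero    = sym (+-identityʳ _)
  ⋆-coeff f g (suc k) = begin
    f 0 * g (suc k) + ((f ∘ suc) ⋆ g) k
      ≈⟨ +-congˡ (⋆-coeff (f ∘ suc) g k) ⟩
    f 0 * g (suc k) + sumF (map (λ i → f (suc i) * g (k ∸ i)) (upTo (suc k)))
      ≡⟨ ≡.cong sumF (map-upTo-suc (λ i → f i * g (suc k ∸ i)) (suc k)) ⟨
    sumF (map (λ i → f i * g (suc k ∸ i)) (upTo (suc (suc k))))
      ∎

  zero-⋆ : ∀ g k → ((λ _ → 0#) ⋆ g) k ≈ 0#
  zero-⋆ g zero    = zeroˡ _
  zero-⋆ g (suc k) = trans (+-cong (zeroˡ _) (zero-⋆ g k)) (+-identityʳ 0#)

  𝟙-⋆ : ∀ g → 𝟙 ⋆ g ≋ g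
  𝟙-⋆ g zero    = *-identityˡ _
  𝟙-⋆ g (suc k) = trans (+-cong (*-identityˡ _) (zero-⋆ g k)) (+-identityʳ _)

  ⋆-linearˡ : ∀ x p q g k → ((λ i → p i - x * q i) ⋆ g) k ≈ (p ⋆ g) k - x * (q ⋆ g) k
  ⋆-linearˡ x p q g zero    = solve 4 (λ a x b c → (a :- x :* b) :* c := a :* c :- x :* (b :* c)) refl (p 0) x (q 0) (g 0)
  ⋆-linearˡ x p q g (suc k) = begin
    (p 0 - x * q 0) * g (suc k) + ((λ i → p (suc i) - x * q (suc i)) ⋆ g) k
      ≈⟨ +-congˡ (⋆-linearˡ x (p ∘ suc) (q ∘ suc) g k) ⟩
    (p 0 - x * q 0) * g (suc k) + (P - x * Q)
      ≈⟨ solve 6 (λ a x b c d e → (a :- x :* b) :* c :+ (d :- x :* e) := (a :* c :+ d) :- x :* (b :* c :+ e))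
           refl (p 0) x (q 0) (g (suc k)) P Q ⟩
    (p 0 * g (suc k) + P) - x * (q 0 * g (suc k) + Q)
      ∎
    where P = ((p ∘ suc) ⋆ g) k; Q = ((q ∘ suc) ⋆ g) k

  [1-t]·-⋆ : ∀ x f g → [1- x t]· (f ⋆ g) ≋ ([1- x t]· f) ⋆ g
  [1-t]·-⋆ x f g zero    = refl
  [1-t]·-⋆ x f g (suc k) = begin
    (f 0 * g (suc k) + ((f ∘ suc) ⋆ g) k) - x * (f ⋆ g) k    ≈⟨ +-assoc _ _ _ ⟩
    f 0 * g (suc k) + (((f ∘ suc) ⋆ g) k - x * (f ⋆ g) k)    ≈⟨ +-congˡ (⋆-linearˡ x (f ∘ suc) f g k) ⟨
    f 0 * g (suc k) + ((λ i → f (suc i) - x * f i) ⋆ g) k    ∎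

  [1-t]⁻¹·-⋆ : ∀ x f g → ([1- x t]⁻¹· f) ⋆ g ≋ [1- x t]⁻¹· (f ⋆ g)
  [1-t]⁻¹·-⋆ x f g = [1-t]·-injective x (≋-trans ([1-t]·-⋆ x ([1- x t]⁻¹· f) g)
    (≋-trans (⋆-congˡ g ([1-t]·[1-t]⁻¹· x f)) (≋-sym ([1-t]·[1-t]⁻¹· x (f ⋆ g)))))

  ∏[1-t]⁻¹·-⋆ : ∀ xs f g → (∏[1- xs t]⁻¹· f) ⋆ g ≋ ∏[1- xs t]⁻¹· (f ⋆ g)
  ∏[1-t]⁻¹·-⋆ []       f g = λ k → refl
  ∏[1-t]⁻¹·-⋆ (x ∷ xs) f g = ≋-trans ([1-t]⁻¹·-⋆ x _ g) ([1-t]⁻¹·-cong x (∏[1-t]⁻¹·-⋆ xs f g))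

  t·[1-t]· : ∀ x f → t· [1- x t]· f ≋ [1- x t]· t· f
  t·[1-t]· x f zero          = refl
  t·[1-t]· x f (suc zero)    = solve 2 (λ a x → a := a :- x :* con (+ 0)) refl (f 0) x
  t·[1-t]· x f (suc (suc k)) = refl

  [1-t]·-combination : ∀ {α β γ x u v} → α ≈ β - γ → α * x ≈ β * u - γ * v →
    ∀ f k → α * ([1- x t]· f) k ≈ β * ([1- u t]· f) k - γ * ([1- v t]· f) k
  [1-t]·-combination {α} {β} {γ} α≈β-γ αx≈βu-γv f zero = begin
    α * f 0                  ≈⟨ *-congʳ α≈β-γ ⟩
    (β - γ) * f 0            ≈⟨ solve 3 (λ β γ a → (β :- γ) :* a := β :* a :- γ :* a) refl β γ (f 0) ⟩
    β * f 0 - γ * f 0        ∎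
  [1-t]·-combination {α} {β} {γ} {x} {u} {v} α≈β-γ αx≈βu-γv f (suc k) = begin
    α * (f (suc k) - x * f k)
      ≈⟨ solve 4 (λ α x a b → α :* (a :- x :* b) := α :* a :- (α :* x) :* b) refl α x (f (suc k)) (f k) ⟩
    α * f (suc k) - (α * x) * f k
      ≈⟨ +-cong (*-congʳ α≈β-γ) (-‿cong (*-congʳ αx≈βu-γv)) ⟩
    (β - γ) * f (suc k) - (β * u - γ * v) * f k
      ≈⟨ solve 6 (λ β γ u v a b → (β :- γ) :* a :- (β :* u :- γ :* v) :* b := β :* (a :- u :* b) :- γ :* (a :- v :* b))
           refl β γ u v (f (suc k)) (f k) ⟩
    β * (f (suc k) - u * f k) - γ * (f (suc k) - v * f k)
      ∎

  [1-t]·-t·-combination : ∀ {α β γ x u} → α ≈ β → α * x ≈ β * u + γ →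
    ∀ f k → α * ([1- x t]· f) k ≈ β * ([1- u t]· f) k - γ * (t· f) k
  [1-t]·-t·-combination {α} {β} {γ} α≈β αx≈βu+γ f zero = begin
    α * f 0                  ≈⟨ *-congʳ α≈β ⟩
    β * f 0                  ≈⟨ solve 3 (λ β γ a → β :* a := β :* a :- γ :* con (+ 0)) refl β γ (f 0) ⟩
    β * f 0 - γ * 0#         ∎
  [1-t]·-t·-combination {α} {β} {γ} {x} {u} α≈β αx≈βu+γ f (suc k) = begin
    α * (f (suc k) - x * f k)
      ≈⟨ solve 4 (λ α x a b → α :* (a :- x :* b) := α :* a :- (α :* x) :* b) refl α x (f (suc k)) (f k) ⟩
    α * f (suc k) - (α * x) * f k
      ≈⟨ +-cong (*-congʳ α≈β) (-‿cong (*-congʳ αx≈βu+γ)) ⟩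
    β * f (suc k) - (β * u + γ) * f k
      ≈⟨ solve 5 (λ β γ u a b → β :* a :- (β :* u :+ γ) :* b := β :* (a :- u :* b) :- γ :* b) refl β γ u (f (suc k)) (f k) ⟩
    β * (f (suc k) - u * f k) - γ * f k
      ∎

  -- Complete homogeneous polynomials and binomial coefficients

  hSeries : List Carrier → Series
  hSeries xs m = h m xs

  hSeries-[] : hSeries [] ≋ 𝟙
  hSeries-[] zero    = +-identityʳ 1#
  hSeries-[] (suc m) = refl

  h-∷ : ∀ x xs m → h m (x ∷ xs) ≈ sumF (map (λ k → x ^ₙ k * h (m ∸ k) xs) (upTo (suc m)))
  h-∷ x xs m = begin
    h m (x ∷ xs)
      ≈⟨ sumF-concatMap monomial (λ k → map (k ∷_) (compositions (length xs) (m ∸ k))) (upTo (suc m)) ⟩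
    sumF (map (λ k → sumF (map monomial (map (k ∷_) (compositions (length xs) (m ∸ k))))) (upTo (suc m)))
      ≈⟨ sumF-cong (upTo (suc m)) first-exponent ⟩
    sumF (map (λ k → x ^ₙ k * h (m ∸ k) xs) (upTo (suc m)))
      ∎
    where
    monomial : List ℕ → Carrier
    monomial ks = prodF (zipWith _^ₙ_ (x ∷ xs) ks)
    first-exponent : ∀ k → sumF (map monomial (map (k ∷_) (compositions (length xs) (m ∸ k)))) ≈ x ^ₙ k * h (m ∸ k) xs
    first-exponent k = trans (reflexive (≡.cong sumF (≡.sym (List.map-∘ (compositions (length xs) (m ∸ k))))))
      (sumF-*ˡ (x ^ₙ k) (λ ks → prodF (zipWith _^ₙ_ xs ks)) (compositions (length xs) (m ∸ k)))

  hSeries-∷ : ∀ x xs → hSeries (x ∷ xs) ≋ [1- x t]⁻¹· hSeries xs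
  hSeries-∷ x xs zero    = trans (h-∷ x xs 0) (trans (+-identityʳ _) (*-identityˡ _))
  hSeries-∷ x xs (suc m) = begin
    h (suc m) (x ∷ xs)
      ≈⟨ h-∷ x xs (suc m) ⟩
    sumF (map (λ k → x ^ₙ k * h (suc m ∸ k) xs) (upTo (suc (suc m))))
      ≡⟨ ≡.cong sumF (map-upTo-suc (λ k → x ^ₙ k * h (suc m ∸ k) xs) (suc m)) ⟩
    1# * h (suc m) xs + sumF (map (λ k → (x * x ^ₙ k) * h (m ∸ k) xs) (upTo (suc m)))
      ≈⟨ +-cong (*-identityˡ _) (sumF-cong (upTo (suc m)) (λ k → *-assoc _ _ _)) ⟩
    h (suc m) xs + sumF (map (λ k → x * (x ^ₙ k * h (m ∸ k) xs)) (upTo (suc m)))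
      ≈⟨ +-congˡ (sumF-*ˡ x _ (upTo (suc m))) ⟩
    h (suc m) xs + x * sumF (map (λ k → x ^ₙ k * h (m ∸ k) xs) (upTo (suc m)))
      ≈⟨ +-congˡ (*-congˡ (trans (sym (h-∷ x xs m)) (hSeries-∷ x xs m))) ⟩
    h (suc m) xs + x * ([1- x t]⁻¹· hSeries xs) m
      ∎

  hSeries≋∏ : ∀ xs → hSeries xs ≋ ∏[1- xs t]⁻¹· 𝟙
  hSeries≋∏ []       = hSeries-[]
  hSeries≋∏ (x ∷ xs) = ≋-trans (hSeries-∷ x xs) ([1-t]⁻¹·-cong x (hSeries≋∏ xs))

  fromℕ-+ : ∀ a b → fromℕ (a +ℕ b) ≈ fromℕ a + fromℕ b
  fromℕ-+ zero    b = sym (+-identityˡ _)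
  fromℕ-+ (suc a) b = trans (+-congˡ (fromℕ-+ a b)) (sym (+-assoc _ _ _))

  binomials : ℕ → Series
  binomials m = ∏[1- replicate (suc m) 1# t]⁻¹· 𝟙

  1^ₙ≈1 : ∀ j → 1# ^ₙ j ≈ 1#
  1^ₙ≈1 zero    = refl
  1^ₙ≈1 (suc j) = trans (*-identityˡ _) (1^ₙ≈1 j)

  binomials-zero : ∀ j → binomials 0 j ≈ 1#
  binomials-zero j = trans ([1-t]⁻¹·𝟙 1# j) (1^ₙ≈1 j)

  binomials-coeff : ∀ m j → binomials m j ≈ fromℕ ((m +ℕ j) C j)
  binomials-coeff zero    j       = begin
    binomials 0 j           ≈⟨ binomials-zero j ⟩
    1#                      ≈⟨ +-identityʳ 1# ⟨
    fromℕ 1                 ≡⟨ ≡.cong fromℕ (nCn≡1 j) ⟨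
    fromℕ (j C j)           ∎
  binomials-coeff (suc m) zero    = trans (reflexive (∏[1-t]⁻¹·-head (replicate (suc (suc m)) 1#) 𝟙)) (sym (+-identityʳ 1#))
  binomials-coeff (suc m) (suc j) = begin
    binomials m (suc j) + 1# * binomials (suc m) j
      ≈⟨ +-cong (binomials-coeff m (suc j)) (trans (*-identityˡ _) (binomials-coeff (suc m) j)) ⟩
    fromℕ ((m +ℕ suc j) C suc j) + fromℕ ((suc m +ℕ j) C j)
      ≈⟨ fromℕ-+ ((m +ℕ suc j) C suc j) ((suc m +ℕ j) C j) ⟨
    fromℕ ((m +ℕ suc j) C suc j +ℕ (suc m +ℕ j) C j)
      ≡⟨ ≡.cong fromℕ pascal ⟩
    fromℕ ((suc m +ℕ suc j) C suc j)
      ∎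
    where
    pascal : (m +ℕ suc j) C suc j +ℕ (suc m +ℕ j) C j ≡ (suc m +ℕ suc j) C suc j
    pascal rewrite ℕ.+-suc m j = ≡.trans (ℕ.+-comm _ (suc (m +ℕ j) C j)) (nCk+nC[k+1]≡[n+1]C[k+1] (suc (m +ℕ j)) j)

  h-replicate : ∀ x k m → (∏[1- replicate (suc k) x t]⁻¹· 𝟙) m ≈ x ^ₙ m * binomials m k
  h-replicate x zero    m = begin
    ([1- x t]⁻¹· 𝟙) m      ≈⟨ [1-t]⁻¹·𝟙 x m ⟩
    x ^ₙ m                 ≈⟨ *-identityʳ _ ⟨
    x ^ₙ m * 1#            ≡⟨ ≡.cong (x ^ₙ m *_) (∏[1-t]⁻¹·-head (replicate (suc m) 1#) 𝟙) ⟨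
    x ^ₙ m * binomials m 0 ∎
  h-replicate x (suc k) zero    = begin
    (∏[1- replicate (suc (suc k)) x t]⁻¹· 𝟙) zero  ≡⟨ ∏[1-t]⁻¹·-head (replicate (suc (suc k)) x) 𝟙 ⟩
    1#                                            ≈⟨ binomials-zero (suc k) ⟨
    binomials 0 (suc k)                           ≈⟨ *-identityˡ _ ⟨
    1# * binomials 0 (suc k)                      ∎
  h-replicate x (suc k) (suc m) = begin
    (∏[1- replicate (suc k) x t]⁻¹· 𝟙) (suc m) + x * (∏[1- replicate (suc (suc k)) x t]⁻¹· 𝟙) m
      ≈⟨ +-cong (h-replicate x k (suc m)) (*-congˡ (h-replicate x (suc k) m)) ⟩
    (x * x ^ₙ m) * binomials (suc m) k + x * (x ^ₙ m * binomials m (suc k))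
      ≈⟨ solve 4 (λ x X a b → (x :* X) :* a :+ x :* (X :* b) := (x :* X) :* (b :+ a))
           refl x (x ^ₙ m) (binomials (suc m) k) (binomials m (suc k)) ⟩
    (x * x ^ₙ m) * (binomials m (suc k) + binomials (suc m) k)
      ≈⟨ *-congˡ (+-congˡ (*-identityˡ _)) ⟨
    (x * x ^ₙ m) * binomials (suc m) (suc k)
      ∎

  repList-suc : ∀ {n} (v : Fin (suc n) → Carrier) κ →
    repList v κ ≡ replicate (κ zero) (v zero) ++ repList (v ∘ suc) (κ ∘ suc)
  repList-suc v κ = ⨁-suc (List.++-monoid Carrier) (λ d → replicate (κ d) (v d))

  repList-cong : ∀ {n} (v : Fin n → Carrier) {κ κ′} → (∀ d → κ d ≡ κ′ d) → repList v κ ≡ repList v κ′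
  repList-cong v κ≡κ′ = ⨁-cong (List.++-monoid Carrier) _ _ (λ d → ≡.cong (λ k → replicate k (v d)) (κ≡κ′ d))

  repList-single : ∀ {n} (v : Fin n → Carrier) κ a → (∀ d → d ≢ a → κ d ≡ 0) → repList v κ ≡ replicate (κ a) (v a)
  repList-single v κ a κ≡0 =
    ⨁-single (List.++-monoid Carrier) _ a (λ d d≢a → ≡.cong (λ k → replicate k (v d)) (κ≡0 d d≢a))

  ∏-repList-+𝐞 : ∀ {n} (v : Fin n → Carrier) {κ κ′ b} → κ ≗ κ′ +𝐞 b →
    ∀ f → ∏[1- repList v κ t]⁻¹· f ≋ [1- v b t]⁻¹· ∏[1- repList v κ′ t]⁻¹· f
  ∏-repList-+𝐞 {suc n} v {κ} {κ′} {b} κ=κ′+b f = ≋-trans (≡⇒≋ (split κ)) (step b κ=κ′+b)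
    where
    rest : (Fin (suc n) → ℕ) → Series
    rest κ = ∏[1- repList (v ∘ suc) (κ ∘ suc) t]⁻¹· f
    split : ∀ κ → ∏[1- repList v κ t]⁻¹· f ≡ ∏[1- replicate (κ zero) (v zero) t]⁻¹· rest κ
    split κ = ≡.trans (≡.cong (λ xs → ∏[1- xs t]⁻¹· f) (repList-suc v κ))
                      (∏[1-t]⁻¹·-++ (replicate (κ zero) (v zero)) (repList (v ∘ suc) (κ ∘ suc)) f)
    step : ∀ b → κ ≗ κ′ +𝐞 b →
      ∏[1- replicate (κ zero) (v zero) t]⁻¹· rest κ ≋ [1- v b t]⁻¹· ∏[1- repList v κ′ t]⁻¹· f
    step zero κ=κ′+0 rewrite at κ=κ′+0 =
      [1-t]⁻¹·-cong (v zero) (≋-trans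
        (≡⇒≋ (≡.cong (λ xs → ∏[1- replicate (κ′ zero) (v zero) t]⁻¹· ∏[1- xs t]⁻¹· f)
                     (repList-cong (v ∘ suc) (λ d → elsewhere κ=κ′+0 (suc d) λ ()))))
        (≋-sym (≡⇒≋ (split κ′))))
    step (suc b) κ=κ′+b rewrite elsewhere κ=κ′+b zero (λ ()) =
      ≋-trans (∏[1-t]⁻¹·-cong (replicate (κ′ zero) (v zero)) (∏-repList-+𝐞 (v ∘ suc) (+𝐞-tail κ=κ′+b) f))
      (≋-trans (∏[1-t]⁻¹·-comm (replicate (κ′ zero) (v zero)) (v (suc b)) _)
               ([1-t]⁻¹·-cong (v (suc b)) (≋-sym (≡⇒≋ (split κ′)))))

  binomial-sum : ∀ p (φ : Series) z m k →
    sumF (map (λ r → p * φ (k ∸ r) * fromℕ ((m +ℕ r ∸ 1) C (r ∸ 1)) * z ^ₙ m) (map suc (upTo k)))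
      ≈ p * z ^ₙ m * (t· ∏[1- replicate (suc m) 1# t]⁻¹· φ) k
  binomial-sum p φ z m zero    = sym (zeroʳ _)
  binomial-sum p φ z m (suc k) = begin
    sumF (map term (map suc (upTo (suc k))))
      ≡⟨ ≡.cong sumF (List.map-∘ (upTo (suc k))) ⟨
    sumF (map (term ∘ suc) (upTo (suc k)))
      ≈⟨ sumF-cong (upTo (suc k)) rearrange ⟩
    sumF (map (λ j → p * z ^ₙ m * (binomials m j * φ (k ∸ j))) (upTo (suc k)))
      ≈⟨ sumF-*ˡ (p * z ^ₙ m) _ (upTo (suc k)) ⟩
    p * z ^ₙ m * sumF (map (λ j → binomials m j * φ (k ∸ j)) (upTo (suc k)))
      ≈⟨ *-congˡ (⋆-coeff (binomials m) φ k) ⟨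
    p * z ^ₙ m * (binomials m ⋆ φ) k
      ≈⟨ *-congˡ (∏[1-t]⁻¹·-⋆ (replicate (suc m) 1#) 𝟙 φ k) ⟩
    p * z ^ₙ m * (∏[1- replicate (suc m) 1# t]⁻¹· (𝟙 ⋆ φ)) k
      ≈⟨ *-congˡ (∏[1-t]⁻¹·-cong (replicate (suc m) 1#) (𝟙-⋆ φ) k) ⟩
    p * z ^ₙ m * (∏[1- replicate (suc m) 1# t]⁻¹· φ) k
      ∎
    where
    term : ℕ → Carrier
    term r = p * φ (suc k ∸ r) * fromℕ ((m +ℕ r ∸ 1) C (r ∸ 1)) * z ^ₙ m
    rearrange : ∀ j → term (suc j) ≈ p * z ^ₙ m * (binomials m j * φ (k ∸ j))
    rearrange j = begin
      p * φ (k ∸ j) * fromℕ ((m +ℕ suc j ∸ 1) C j) * z ^ₙ m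
        ≡⟨ ≡.cong (λ i → p * φ (k ∸ j) * fromℕ ((i ∸ 1) C j) * z ^ₙ m) (ℕ.+-suc m j) ⟩
      p * φ (k ∸ j) * fromℕ ((m +ℕ j) C j) * z ^ₙ m
        ≈⟨ *-congʳ (*-congˡ (binomials-coeff m j)) ⟨
      p * φ (k ∸ j) * binomials m j * z ^ₙ m
        ≈⟨ solve 4 (λ p f b z → p :* f :* b :* z := (p :* z) :* (b :* f)) refl p (φ (k ∸ j)) (binomials m j) (z ^ₙ m) ⟩
      p * z ^ₙ m * (binomials m j * φ (k ∸ j))
        ∎

  -- The two sides of the identity

  module _ {n} (y : Fin n → Carrier) (y-injective : ∀ i j → i ≢ j → ¬ (y i ≈ y j)) where

    y-y≉0 : ∀ {i j} → i ≢ j → y i - y j ≉ 0#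
    y-y≉0 {i} {j} i≢j = -≉0 (y-injective i j i≢j)

    numerator : Fin n → (Fin n → ℕ) → Carrier
    numerator s κ = (- y s) ^ₙ (∣ κ ∣ₖ ∸ κ s)

    denominator : Fin n → (Fin n → ℕ) → Carrier
    denominator s κ = prodF (map (λ d → (y d - y s) ^ₙ κ d) (others s))

    prefactor : Fin n → (Fin n → ℕ) → Carrier
    prefactor s κ = numerator s κ / denominator s κ

    w : Fin n → Fin n → Carrier
    w s d = y d / (y d - y s)

    wSeries : Fin n → (Fin n → ℕ) → Series
    wSeries s κ = hSeries (wList y κ s)

    denominator-zeroAt : ∀ s κ → denominator s κ ≈ prodF (map (λ d → (y d - y s) ^ₙ zeroAt s κ d) (allFin n))
    denominator-zeroAt s κ = foldr-filter-≢ *-monoid s _ _ (allFin n)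
      (λ d d≢s → reflexive (≡.cong ((y d - y s) ^ₙ_) (≡.sym (updateAt-minimal d s κ d≢s))))
      (reflexive (≡.cong ((y s - y s) ^ₙ_) (updateAt-updates s κ)))

    denominator-≉0 : ∀ s κ → denominator s κ ≉ 0#
    denominator-≉0 s κ den≈0 = prodF-≉0 _ (allFin n) factor-≉0 (trans (sym (denominator-zeroAt s κ)) den≈0)
      where
      factor-≉0 : ∀ d → (y d - y s) ^ₙ zeroAt s κ d ≉ 0#
      factor-≉0 d with d ≟ s
      ... | yes ≡.refl = ≡.subst (λ k → (y s - y s) ^ₙ k ≉ 0#) (≡.sym (updateAt-updates s κ)) (0≉1 ∘ sym)
      ... | no d≢s     = ^ₙ-≉0 (zeroAt s κ d) (y-y≉0 d≢s)

    wList-zeroAt : ∀ s κ → wList y κ s ≡ repList (w s) (zeroAt s κ)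
    wList-zeroAt s κ = foldr-filter-≢ (List.++-monoid Carrier) s _ _ (allFin n)
      (λ d d≢s → ≡.cong (λ k → replicate k (w s d)) (≡.sym (updateAt-minimal d s κ d≢s)))
      (≡.cong (λ k → replicate k (w s s)) (updateAt-updates s κ))

    wSeries-+𝐞 : ∀ {s b κ κ′} → s ≢ b → κ ≗ κ′ +𝐞 b → wSeries s κ ≋ [1- w s b t]⁻¹· wSeries s κ′
    wSeries-+𝐞 {s} {b} {κ} {κ′} s≢b κ=κ′+b = ≋-trans (as-∏ κ)
      (≋-trans (∏-repList-+𝐞 (w s) (zeroAt-+𝐞 s≢b κ=κ′+b) 𝟙) ([1-t]⁻¹·-cong (w s b) (≋-sym (as-∏ κ′))))
      where
      as-∏ : ∀ κ → wSeries s κ ≋ ∏[1- repList (w s) (zeroAt s κ) t]⁻¹· 𝟙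
      as-∏ κ = ≋-trans (≡⇒≋ (≡.cong hSeries (wList-zeroAt s κ))) (hSeries≋∏ (repList (w s) (zeroAt s κ)))

    wSeries-agree : ∀ {s κ κ′} → (∀ d → d ≢ s → κ d ≡ κ′ d) → wSeries s κ ≋ wSeries s κ′
    wSeries-agree {s} {κ} {κ′} κ≡κ′ = ≡⇒≋ (≡.cong hSeries (≡.trans (wList-zeroAt s κ)
      (≡.trans (repList-cong (w s) (λ d → zeroAt-agree s d (κ≡κ′ d))) (≡.sym (wList-zeroAt s κ′)))))

    denominator-+𝐞 : ∀ {s b κ κ′} → s ≢ b → κ ≗ κ′ +𝐞 b → denominator s κ ≈ (y b - y s) * denominator s κ′
    denominator-+𝐞 {s} {b} {κ} {κ′} s≢b κ=κ′+b = begin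
      denominator s κ
        ≈⟨ denominator-zeroAt s κ ⟩
      prodF (map (λ d → (y d - y s) ^ₙ zeroAt s κ d) (allFin n))
        ≈⟨ prodF-^ₙ-+𝐞 (λ d → y d - y s) (zeroAt-+𝐞 s≢b κ=κ′+b) ⟩
      (y b - y s) * prodF (map (λ d → (y d - y s) ^ₙ zeroAt s κ′ d) (allFin n))
        ≈⟨ *-congˡ (denominator-zeroAt s κ′) ⟨
      (y b - y s) * denominator s κ′
        ∎

    prefactor-+𝐞 : ∀ {s b κ κ′} → s ≢ b → κ ≗ κ′ +𝐞 b → y s * prefactor s κ′ ≈ (y s - y b) * prefactor s κ
    prefactor-+𝐞 {s} {b} {κ} {κ′} s≢b κ=κ′+b = sym (begin
      (y s - y b) * (numerator s κ * denominator s κ ⁻¹)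
        ≡⟨ ≡.cong (λ e → (y s - y b) * ((- y s) ^ₙ e * denominator s κ ⁻¹)) exponent ⟩
      (y s - y b) * ((- y s) * N * denominator s κ ⁻¹)
        ≈⟨ *-congˡ (*-congˡ den⁻¹) ⟩
      (y s - y b) * ((- y s) * N * ((y b - y s) ⁻¹ * D ⁻¹))
        ≈⟨ solve 6 (λ ys yb N i j g → (ys :- yb) :* ((:- ys) :* N :* (i :* j)) := ys :* (N :* j) :* ((yb :- ys) :* i))
             refl (y s) (y b) N ((y b - y s) ⁻¹) (D ⁻¹) (y b - y s) ⟩
      y s * (N * D ⁻¹) * ((y b - y s) * (y b - y s) ⁻¹)
        ≈⟨ *-congˡ (⁻¹-inverse _ yb-ys≉0) ⟩
      y s * (N * D ⁻¹) * 1#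
        ≈⟨ *-identityʳ _ ⟩
      y s * prefactor s κ′
        ∎)
      where
      N = numerator s κ′
      D = denominator s κ′
      yb-ys≉0 : y b - y s ≉ 0#
      yb-ys≉0 = y-y≉0 (s≢b ∘ ≡.sym)
      exponent : ∣ κ ∣ₖ ∸ κ s ≡ suc (∣ κ′ ∣ₖ ∸ κ′ s)
      exponent rewrite ∣∣ₖ-+𝐞 κ=κ′+b | elsewhere κ=κ′+b s s≢b = ℕ.+-∸-assoc 1 (≤∣∣ₖ κ′ s)
      den⁻¹ : denominator s κ ⁻¹ ≈ (y b - y s) ⁻¹ * D ⁻¹
      den⁻¹ = trans (⁻¹-cong (denominator-≉0 s κ) (denominator-+𝐞 s≢b κ=κ′+b))
                    (⁻¹-distrib-* yb-ys≉0 (denominator-≉0 s κ′))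

    prefactor-+𝐞-self : ∀ {s κ κ′} → κ ≗ κ′ +𝐞 s → prefactor s κ′ ≈ prefactor s κ
    prefactor-+𝐞-self {s} {κ} {κ′} κ=κ′+s =
      *-cong (reflexive (≡.cong ((- y s) ^ₙ_) exponent)) (⁻¹-cong (denominator-≉0 s κ′) same-denominator)
      where
      exponent : ∣ κ′ ∣ₖ ∸ κ′ s ≡ ∣ κ ∣ₖ ∸ κ s
      exponent rewrite ∣∣ₖ-+𝐞 κ=κ′+s | at κ=κ′+s = ≡.refl
      same-denominator : denominator s κ′ ≈ denominator s κ
      same-denominator = begin
        denominator s κ′
          ≈⟨ denominator-zeroAt s κ′ ⟩
        prodF (map (λ d → (y d - y s) ^ₙ zeroAt s κ′ d) (allFin n))
          ≡⟨ ≡.cong prodF (List.map-cong (λ d → ≡.cong ((y d - y s) ^ₙ_) (zeroAt-agree s d (≡.sym ∘ elsewhere κ=κ′+s d))) (allFin n)) ⟩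
        prodF (map (λ d → (y d - y s) ^ₙ zeroAt s κ d) (allFin n))
          ≈⟨ denominator-zeroAt s κ ⟨
        denominator s κ
          ∎

    w-identity : ∀ {s b} → s ≢ b → (y s - y b) * w s b ≈ - y b
    w-identity {s} {b} s≢b = begin
      (y s - y b) * (y b * (y b - y s) ⁻¹)
        ≈⟨ solve 3 (λ s b i → (s :- b) :* (b :* i) := :- (b :* ((b :- s) :* i))) refl (y s) (y b) ((y b - y s) ⁻¹) ⟩
      - (y b * ((y b - y s) * (y b - y s) ⁻¹))
        ≈⟨ -‿cong (*-congˡ (⁻¹-inverse _ (y-y≉0 (s≢b ∘ ≡.sym)))) ⟩
      - (y b * 1#)
        ≈⟨ -‿cong (*-identityʳ (y b)) ⟩
      - y b
        ∎

    rhsSeries : Fin n → (Fin n → ℕ) → ℕ → Series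
    rhsSeries s κ m = ∏[1- replicate (suc m) 1# t]⁻¹· wSeries s κ

    rhsSeries-+𝐞 : ∀ {s b κ κ′} m → s ≢ b → κ ≗ κ′ +𝐞 b →
      rhsSeries s κ′ (suc m) ≋ [1- w s b t]· rhsSeries s κ (suc m)
    rhsSeries-+𝐞 {s} {b} {κ} {κ′} m s≢b κ=κ′+b =
      ≋-trans (≋-sym ([1-t]·[1-t]⁻¹· (w s b) _)) ([1-t]·-cong (w s b) (≋-sym
        (≋-trans (∏[1-t]⁻¹·-cong (replicate (suc (suc m)) 1#) (wSeries-+𝐞 s≢b κ=κ′+b))
                 (∏[1-t]⁻¹·-comm (replicate (suc (suc m)) 1#) (w s b) (wSeries s κ′)))))

    rhsSeries-agree : ∀ {s κ κ′} m → (∀ d → d ≢ s → κ d ≡ κ′ d) → rhsSeries s κ m ≋ rhsSeries s κ′ m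
    rhsSeries-agree m κ≡κ′ = ∏[1-t]⁻¹·-cong (replicate (suc m) 1#) (wSeries-agree κ≡κ′)

    rhsTerm′ : Fin n → (Fin n → ℕ) → ℕ → Carrier
    rhsTerm′ s κ m = prefactor s κ * y s ^ₙ m * (t· rhsSeries s κ m) (κ s)

    rhsTerm′-+𝐞 : ∀ {s b κ κ′} m → s ≢ b → κ ≗ κ′ +𝐞 b →
      rhsTerm′ s κ′ (suc m) ≈ prefactor s κ * y s ^ₙ m * ((y s - y b) * ([1- w s b t]· t· rhsSeries s κ (suc m)) (κ s))
    rhsTerm′-+𝐞 {s} {b} {κ} {κ′} m s≢b κ=κ′+b = begin
      prefactor s κ′ * (y s * y s ^ₙ m) * (t· rhsSeries s κ′ (suc m)) (κ′ s)
        ≡⟨ ≡.cong (λ i → prefactor s κ′ * (y s * y s ^ₙ m) * (t· rhsSeries s κ′ (suc m)) i) (elsewhere κ=κ′+b s s≢b) ⟨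
      prefactor s κ′ * (y s * y s ^ₙ m) * (t· rhsSeries s κ′ (suc m)) (κ s)
        ≈⟨ *-congˡ (trans (t·-cong (rhsSeries-+𝐞 m s≢b κ=κ′+b) (κ s)) (t·[1-t]· (w s b) _ (κ s))) ⟩
      prefactor s κ′ * (y s * y s ^ₙ m) * ([1- w s b t]· t· rhsSeries s κ (suc m)) (κ s)
        ≈⟨ rescale (y s ^ₙ m) _ (prefactor-+𝐞 s≢b κ=κ′+b) ⟩
      prefactor s κ * y s ^ₙ m * ((y s - y b) * ([1- w s b t]· t· rhsSeries s κ (suc m)) (κ s))
        ∎

    -- (y_a − y_b)(1 − t) = (y_s − y_b)(1 − w_b t) − (y_s − y_a)(1 − w_a t)
    rhsTerm′-recurrence-other : ∀ {a b s κ κa κb} m → s ≢ a → s ≢ b → κ ≗ κa +𝐞 a → κ ≗ κb +𝐞 b →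
      (y a - y b) * rhsTerm′ s κ m ≈ rhsTerm′ s κb (suc m) - rhsTerm′ s κa (suc m)
    rhsTerm′-recurrence-other {a} {b} {s} {κ} {κa} {κb} m s≢a s≢b κ=κa+a κ=κb+b = begin
      (y a - y b) * (P * (t· rhsSeries s κ m) (κ s))
        ≈⟨ solve 3 (λ α P z → α :* (P :* z) := P :* (α :* z)) refl (y a - y b) P _ ⟩
      P * ((y a - y b) * (t· rhsSeries s κ m) (κ s))
        ≈⟨ *-congˡ (*-congˡ (trans (t·-cong (≋-sym ([1-t]·[1-t]⁻¹· 1# _)) (κ s)) (t·[1-t]· 1# Y (κ s)))) ⟩
      P * ((y a - y b) * ([1- 1# t]· t· Y) (κ s))
        ≈⟨ *-congˡ ([1-t]·-combination α≈β-γ αx≈βu-γv (t· Y) (κ s)) ⟩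
      P * ((y s - y b) * ([1- w s b t]· t· Y) (κ s) - (y s - y a) * ([1- w s a t]· t· Y) (κ s))
        ≈⟨ solve 3 (λ P p q → P :* (p :- q) := P :* p :- P :* q) refl P _ _ ⟩
      P * ((y s - y b) * ([1- w s b t]· t· Y) (κ s)) - P * ((y s - y a) * ([1- w s a t]· t· Y) (κ s))
        ≈⟨ +-cong (rhsTerm′-+𝐞 m s≢b κ=κb+b) (-‿cong (rhsTerm′-+𝐞 m s≢a κ=κa+a)) ⟨
      rhsTerm′ s κb (suc m) - rhsTerm′ s κa (suc m)
        ∎
      where
      P = prefactor s κ * y s ^ₙ m
      Y = rhsSeries s κ (suc m)
      α≈β-γ : y a - y b ≈ (y s - y b) - (y s - y a)
      α≈β-γ = solve 3 (λ a b s → a :- b := (s :- b) :- (s :- a)) refl (y a) (y b) (y s)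
      αx≈βu-γv : (y a - y b) * 1# ≈ (y s - y b) * w s b - (y s - y a) * w s a
      αx≈βu-γv = begin
        (y a - y b) * 1#
          ≈⟨ trans (*-identityʳ _) (solve 2 (λ a b → a :- b := (:- b) :- (:- a)) refl (y a) (y b)) ⟩
        (- y b) - (- y a)
          ≈⟨ +-cong (w-identity s≢b) (-‿cong (w-identity s≢a)) ⟨
        (y s - y b) * w s b - (y s - y a) * w s a
          ∎

    -- (y_a − y_b)(1 − t) = (y_a − y_b)(1 − w_b t) − y_a t
    rhsTerm′-recurrence-at : ∀ {a b κ κa κb} m → a ≢ b → κ ≗ κa +𝐞 a → κ ≗ κb +𝐞 b →
      (y a - y b) * rhsTerm′ a κ m ≈ rhsTerm′ a κb (suc m) - rhsTerm′ a κa (suc m)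
    rhsTerm′-recurrence-at {a} {b} {κ} {κa} {κb} m a≢b κ=κa+a κ=κb+b = begin
      (y a - y b) * (P * (t· rhsSeries a κ m) (κ a))
        ≡⟨ ≡.cong (λ i → (y a - y b) * (P * (t· rhsSeries a κ m) i)) (at κ=κa+a) ⟩
      (y a - y b) * (P * rhsSeries a κ m (κa a))
        ≈⟨ solve 3 (λ α P z → α :* (P :* z) := P :* (α :* z)) refl (y a - y b) P _ ⟩
      P * ((y a - y b) * rhsSeries a κ m (κa a))
        ≈⟨ *-congˡ (*-congˡ (sym ([1-t]·[1-t]⁻¹· 1# _ (κa a)))) ⟩
      P * ((y a - y b) * ([1- 1# t]· Y) (κa a))
        ≈⟨ *-congˡ ([1-t]·-t·-combination refl αx≈βu+γ Y (κa a)) ⟩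
      P * ((y a - y b) * ([1- w a b t]· Y) (κa a) - y a * (t· Y) (κa a))
        ≈⟨ solve 3 (λ P p q → P :* (p :- q) := P :* p :- P :* q) refl P _ _ ⟩
      P * ((y a - y b) * ([1- w a b t]· Y) (κa a)) - P * (y a * (t· Y) (κa a))
        ≈⟨ +-cong (*-congˡ (*-congˡ (sym (shifted (κa a))))) (-‿cong at-a) ⟩
      P * ((y a - y b) * ([1- w a b t]· t· Y) (suc (κa a))) - rhsTerm′ a κa (suc m)
        ≡⟨ ≡.cong (λ i → P * ((y a - y b) * ([1- w a b t]· t· Y) i) - rhsTerm′ a κa (suc m)) (at κ=κa+a) ⟨
      P * ((y a - y b) * ([1- w a b t]· t· Y) (κ a)) - rhsTerm′ a κa (suc m)
        ≈⟨ +-congʳ (rhsTerm′-+𝐞 m a≢b κ=κb+b) ⟨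
      rhsTerm′ a κb (suc m) - rhsTerm′ a κa (suc m)
        ∎
      where
      P = prefactor a κ * y a ^ₙ m
      Y = rhsSeries a κ (suc m)
      αx≈βu+γ : (y a - y b) * 1# ≈ (y a - y b) * w a b + y a
      αx≈βu+γ = begin
        (y a - y b) * 1#               ≈⟨ trans (*-identityʳ _) (solve 2 (λ a b → a :- b := (:- b) :+ a) refl (y a) (y b)) ⟩
        - y b + y a                    ≈⟨ +-congʳ (w-identity a≢b) ⟨
        (y a - y b) * w a b + y a      ∎
      shifted : ∀ k → ([1- w a b t]· t· Y) (suc k) ≈ ([1- w a b t]· Y) k
      shifted k = sym (t·[1-t]· (w a b) Y (suc k))
      at-a : P * (y a * (t· Y) (κa a)) ≈ rhsTerm′ a κa (suc m)
      at-a = sym (begin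
        prefactor a κa * (y a * y a ^ₙ m) * (t· rhsSeries a κa (suc m)) (κa a)
          ≈⟨ *-cong (*-congʳ (prefactor-+𝐞-self κ=κa+a))
                    (t·-cong (rhsSeries-agree (suc m) (λ d d≢a → ≡.sym (elsewhere κ=κa+a d d≢a))) (κa a)) ⟩
        prefactor a κ * (y a * y a ^ₙ m) * (t· Y) (κa a)
          ≈⟨ solve 4 (λ p y Y c → p :* (y :* Y) :* c := p :* Y :* (y :* c)) refl (prefactor a κ) (y a) (y a ^ₙ m) _ ⟩
        P * (y a * (t· Y) (κa a))
          ∎)

    rhsTerm′-recurrence : ∀ {a b κ κa κb} m → a ≢ b → κ ≗ κa +𝐞 a → κ ≗ κb +𝐞 b →
      ∀ s → (y a - y b) * rhsTerm′ s κ m ≈ rhsTerm′ s κb (suc m) - rhsTerm′ s κa (suc m)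
    rhsTerm′-recurrence {a} {b} m a≢b κ=κa+a κ=κb+b s with s ≟ a | s ≟ b
    ... | yes ≡.refl | _          = rhsTerm′-recurrence-at m a≢b κ=κa+a κ=κb+b
    ... | no s≢a     | yes ≡.refl = swap (rhsTerm′-recurrence-at m (a≢b ∘ ≡.sym) κ=κb+b κ=κa+a)
      where
      swap : ∀ {z u v} → (y b - y a) * z ≈ u - v → (y a - y b) * z ≈ v - u
      swap {z} {u} {v} eq = begin
        (y a - y b) * z      ≈⟨ solve 3 (λ a b z → (a :- b) :* z := :- ((b :- a) :* z)) refl (y a) (y b) z ⟩
        - ((y b - y a) * z)  ≈⟨ -‿cong eq ⟩
        - (u - v)            ≈⟨ solve 2 (λ u v → :- (u :- v) := v :- u) refl u v ⟩
        v - u                ∎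
    ... | no s≢a     | no s≢b     = rhsTerm′-recurrence-other m s≢a s≢b κ=κa+a κ=κb+b

    lhs : (Fin n → ℕ) → ℕ → Carrier
    lhs κ m = h m (repList y κ)

    rhsTerm : Fin n → (Fin n → ℕ) → ℕ → Carrier
    rhsTerm s κ m = sumF (map (λ r → A y κ s r * fromℕ ((m +ℕ r ∸ 1) C (r ∸ 1)) * (y s ^ₙ m)) (map suc (upTo (κ s))))

    rhs : (Fin n → ℕ) → ℕ → Carrier
    rhs κ m = sumF (map (λ s → rhsTerm s κ m) (allFin n))

    rhsTerm≈rhsTerm′ : ∀ s κ m → rhsTerm s κ m ≈ rhsTerm′ s κ m
    rhsTerm≈rhsTerm′ s κ m = binomial-sum (prefactor s κ) (wSeries s κ) (y s) m (κ s)

    rhs-recurrence : ∀ {a b κ κa κb} m → a ≢ b → κ ≗ κa +𝐞 a → κ ≗ κb +𝐞 b →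
      (y a - y b) * rhs κ m ≈ rhs κb (suc m) - rhs κa (suc m)
    rhs-recurrence {a} {b} {κ} {κa} {κb} m a≢b κ=κa+a κ=κb+b = begin
      (y a - y b) * rhs κ m
        ≈⟨ sumF-*ˡ (y a - y b) (λ s → rhsTerm s κ m) (allFin n) ⟨
      sumF (map (λ s → (y a - y b) * rhsTerm s κ m) (allFin n))
        ≈⟨ sumF-cong (allFin n) termwise ⟩
      sumF (map (λ s → rhsTerm s κb (suc m) - rhsTerm s κa (suc m)) (allFin n))
        ≈⟨ sumF-- (λ s → rhsTerm s κb (suc m)) (λ s → rhsTerm s κa (suc m)) (allFin n) ⟩
      rhs κb (suc m) - rhs κa (suc m)
        ∎
      where
      termwise : ∀ s → (y a - y b) * rhsTerm s κ m ≈ rhsTerm s κb (suc m) - rhsTerm s κa (suc m)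
      termwise s = begin
        (y a - y b) * rhsTerm s κ m                       ≈⟨ *-congˡ (rhsTerm≈rhsTerm′ s κ m) ⟩
        (y a - y b) * rhsTerm′ s κ m                      ≈⟨ rhsTerm′-recurrence m a≢b κ=κa+a κ=κb+b s ⟩
        rhsTerm′ s κb (suc m) - rhsTerm′ s κa (suc m)
          ≈⟨ +-cong (rhsTerm≈rhsTerm′ s κb (suc m)) (-‿cong (rhsTerm≈rhsTerm′ s κa (suc m))) ⟨
        rhsTerm s κb (suc m) - rhsTerm s κa (suc m)       ∎

    hSeries-repList-+𝐞 : ∀ {b κ κ′} → κ ≗ κ′ +𝐞 b → hSeries (repList y κ′) ≋ [1- y b t]· hSeries (repList y κ)
    hSeries-repList-+𝐞 {b} {κ} {κ′} κ=κ′+b = ≋-trans (≋-sym ([1-t]·[1-t]⁻¹· (y b) _)) ([1-t]·-cong (y b) (≋-sym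
      (≋-trans (hSeries≋∏ (repList y κ))
      (≋-trans (∏-repList-+𝐞 y κ=κ′+b 𝟙) ([1-t]⁻¹·-cong (y b) (≋-sym (hSeries≋∏ (repList y κ′))))))))

    lhs-recurrence : ∀ {a b κ κa κb} m → κ ≗ κa +𝐞 a → κ ≗ κb +𝐞 b →
      (y a - y b) * lhs κ m ≈ lhs κb (suc m) - lhs κa (suc m)
    lhs-recurrence {a} {b} {κ} m κ=κa+a κ=κb+b = sym (begin
      lhs _ (suc m) - lhs _ (suc m)
        ≈⟨ +-cong (hSeries-repList-+𝐞 κ=κb+b (suc m)) (-‿cong (hSeries-repList-+𝐞 κ=κa+a (suc m))) ⟩
      (H (suc m) - y b * H m) - (H (suc m) - y a * H m)
        ≈⟨ solve 4 (λ h₁ h₀ a b → (h₁ :- b :* h₀) :- (h₁ :- a :* h₀) := (a :- b) :* h₀) refl (H (suc m)) (H m) (y a) (y b) ⟩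
      (y a - y b) * lhs κ m
        ∎)
      where
      H = hSeries (repList y κ)

    module _ {κ : Fin n → ℕ} {a} (κ≡0 : ∀ d → d ≢ a → κ d ≡ 0) where

      zeroAt-single : ∀ d → zeroAt a κ d ≡ 0
      zeroAt-single d with d ≟ a
      ... | yes ≡.refl = updateAt-updates a κ
      ... | no d≢a     = ≡.trans (updateAt-minimal d a κ d≢a) (κ≡0 d d≢a)

      prefactor-single : prefactor a κ ≈ 1#
      prefactor-single = begin
        numerator a κ * denominator a κ ⁻¹   ≡⟨ ≡.cong (λ e → (- y a) ^ₙ e * denominator a κ ⁻¹) exponent ⟩
        1# * denominator a κ ⁻¹              ≈⟨ *-identityˡ _ ⟩
        denominator a κ ⁻¹                   ≈⟨ ⁻¹-cong (denominator-≉0 a κ) denominator≈1 ⟩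
        1# ⁻¹                                ≈⟨ 1⁻¹≈1 ⟩
        1#                                   ∎
        where
        exponent : ∣ κ ∣ₖ ∸ κ a ≡ 0
        exponent = ≡.trans (≡.cong (_∸ κ a) (∣∣ₖ-single κ a κ≡0)) (ℕ.n∸n≡0 (κ a))
        denominator≈1 : denominator a κ ≈ 1#
        denominator≈1 = trans (denominator-zeroAt a κ)
          (⨁-ε *-monoid _ (λ d → reflexive (≡.cong ((y d - y a) ^ₙ_) (zeroAt-single d))))

      wSeries-single : wSeries a κ ≋ 𝟙
      wSeries-single = ≋-trans (≡⇒≋ (≡.cong hSeries wList≡[])) hSeries-[]
        where
        wList≡[] : wList y κ a ≡ []
        wList≡[] = ≡.trans (wList-zeroAt a κ) (≡.trans (repList-single (w a) (zeroAt a κ) a (λ d _ → zeroAt-single d))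
                                                       (≡.cong (λ k → replicate k (w a a)) (zeroAt-single a)))

      lhs≈rhs-single : ∀ {k} → κ a ≡ suc k → ∀ m → lhs κ m ≈ rhs κ m
      lhs≈rhs-single {k} κa≡1+k m = begin
        h m (repList y κ)
          ≡⟨ ≡.cong (h m) (≡.trans (repList-single y κ a κ≡0) (≡.cong (λ i → replicate i (y a)) κa≡1+k)) ⟩
        h m (replicate (suc k) (y a))
          ≈⟨ hSeries≋∏ (replicate (suc k) (y a)) m ⟩
        (∏[1- replicate (suc k) (y a) t]⁻¹· 𝟙) m
          ≈⟨ h-replicate (y a) k m ⟩
        y a ^ₙ m * binomials m k
          ≈⟨ *-congʳ (*-identityˡ _) ⟨
        1# * y a ^ₙ m * binomials m k
          ≈⟨ *-cong (*-congʳ prefactor-single) (∏[1-t]⁻¹·-cong (replicate (suc m) 1#) wSeries-single k) ⟨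
        prefactor a κ * y a ^ₙ m * rhsSeries a κ m k
          ≡⟨ ≡.cong (λ i → prefactor a κ * y a ^ₙ m * (t· rhsSeries a κ m) i) κa≡1+k ⟨
        rhsTerm′ a κ m
          ≈⟨ rhsTerm≈rhsTerm′ a κ m ⟨
        rhsTerm a κ m
          ≈⟨ ⨁-single +-monoid (λ s → rhsTerm s κ m) a vanishing ⟨
        rhs κ m
          ∎
        where
        vanishing : ∀ d → d ≢ a → rhsTerm d κ m ≈ 0#
        vanishing d d≢a rewrite κ≡0 d d≢a = refl

    lhs≈rhs : ∀ N κ a → 1 ≤ κ a → ∣ κ ∣ₖ ≡ N → ∀ m → lhs κ m ≈ rhs κ m
    lhs≈rhs zero    κ a 1≤κa ∣κ∣≡0 m =
      contradiction (ℕ.≤-trans 1≤κa (≡.subst (κ a ≤_) ∣κ∣≡0 (≤∣∣ₖ κ a))) λ ()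
    lhs≈rhs (suc N) κ a 1≤κa ∣κ∣≡1+N m with any? (λ d → ¬? (d ≟ a) ×-dec (1 ≤? κ d))
    ... | no ∄b =
      lhs≈rhs-single (λ d d≢a → ℕ.n<1⇒n≡0 (ℕ.≰⇒> λ 1≤κd → ∄b (d , d≢a , 1≤κd)))
                     (≡.sym (ℕ.suc-pred (κ a) ⦃ ℕ.>-nonZero 1≤κa ⦄)) m
    ... | yes (b , b≢a , 1≤κb) = *-cancelˡ (y-y≉0 a≢b) (begin
      (y a - y b) * lhs κ m               ≈⟨ lhs-recurrence m κ=κa+a κ=κb+b ⟩
      lhs κb (suc m) - lhs κa (suc m)
        ≈⟨ +-cong (lhs≈rhs N κb a 1≤κb-a ∣κb∣≡N (suc m)) (-‿cong (lhs≈rhs N κa b 1≤κa-b ∣κa∣≡N (suc m))) ⟩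
      rhs κb (suc m) - rhs κa (suc m)     ≈⟨ rhs-recurrence m a≢b κ=κa+a κ=κb+b ⟨
      (y a - y b) * rhs κ m               ∎)
      where
      a≢b = b≢a ∘ ≡.sym
      κa = κ -𝐞 a
      κb = κ -𝐞 b
      κ=κa+a = -𝐞-+𝐞 1≤κa
      κ=κb+b = -𝐞-+𝐞 1≤κb
      1≤κb-a : 1 ≤ κb a
      1≤κb-a = ≡.subst (1 ≤_) (elsewhere κ=κb+b a a≢b) 1≤κa
      1≤κa-b : 1 ≤ κa b
      1≤κa-b = ≡.subst (1 ≤_) (elsewhere κ=κa+a b b≢a) 1≤κb
      ∣κb∣≡N : ∣ κb ∣ₖ ≡ N
      ∣κb∣≡N = ℕ.suc-injective (≡.trans (≡.sym (∣∣ₖ-+𝐞 κ=κb+b)) ∣κ∣≡1+N)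
      ∣κa∣≡N : ∣ κa ∣ₖ ≡ N
      ∣κa∣≡N = ℕ.suc-injective (≡.trans (≡.sym (∣∣ₖ-+𝐞 κ=κa+a)) ∣κ∣≡1+N)

theorem9p1 : ∀ {c ℓ : Level} (F : Field c ℓ) →
    let open Field F in let open FieldOps F in
    CharZero →
    (n : ℕ) → 1 ≤ n →
    (κ : Fin n → ℕ) → (∀ j → 1 ≤ κ j) →
    (m : ℕ) →
    (y : Fin n → Carrier) → (∀ i j → i ≢ j → ¬ (y i ≈ y j)) →
    h m (repList y κ)
      ≈ sumF (map (λ s → sumF (map (λ r →
            A y κ s r * fromℕ ((m +ℕ r ∸ 1) C (r ∸ 1)) * (y s ^ₙ m))
          (map suc (upTo (κ s))))) (allFin n))
theorem9p1 F _ zero    () κ 1≤κ m y y-injective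
theorem9p1 F _ (suc n) _  κ 1≤κ m y y-injective = lhs≈rhs F y y-injective _ κ zero (1≤κ zero) ≡.refl m
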